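{- Let $G=(V,E)$ be a claw-free graph, let $I$ be a maximum independent set of $G$, and for $a\in I$ let $V_a=\{v\in V\setminus I: N(v)\cap I=\{a\}\}$ (the 1-packs). For each $a\in I$ partition $V_a$ as follows: $T0^a$ is the set of $v\in V_a$ with no neighbour in any 1-pack other than $V_a$; for $b\in I\setminus\{a\}$, $T1^a_b$ is the set of $v\in V_a$ that have a neighbour in $V_b$ and no neighbour in any 1-pack other than $V_a$ and $V_b$; and $T2^a$ is the set of $v\in V_a$ having neighbours in at least two distinct 1-packs other than $V_a$. Then for any distinct $a,b\in I$ we have $N(T1^a_b)\cap V_b=T1^b_a$ and $N(T2^a)\cap V_b\subseteq T2^b$.
   Context: A graph is claw-free if it has no induced subgraph isomorphic to $K_{1,3}$. For a vertex set $X$, $N(X)=\left(\bigcup_{x\in X}N[x]\right)\setminus X$. -}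

module Defs where

open import Data.Nat using (ℕ; _≤_)
open import Data.Fin using (Fin)
open import Data.Fin.Subset using (Subset; _∈_; _∉_; ∣_∣)
open import Data.Bool using (Bool; true)
open import Data.Product using (Σ; _×_; ∃)
open import Relation.Binary.PropositionalEquality using (_≡_; _≢_)
open import Relation.Nullary using (¬_)
open import Data.Empty using (⊥)

record Graph (n : ℕ) : Set where
  field
    adj   : Fin n → Fin n → Bool
    sym   : ∀ u v → adj u v ≡ adj v u
    irrefl : ∀ v → adj v v ≡ true → ⊥

module _ {n : ℕ} (G : Graph n) where
  open Graph G

  Adj : Fin n → Fin n → Set
  Adj u v = adj u v ≡ true

  VSet : Set₁
  VSet = Fin n → Set

  ClawFree : Set
  ClawFree = ∀ c x y z → Adj c x → Adj c y → Adj c z →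
             x ≢ y → x ≢ z → y ≢ z →
             ¬ Adj x y → ¬ Adj x z → ¬ Adj y z → ⊥

  Independent : Subset n → Set
  Independent J = ∀ u v → u ∈ J → v ∈ J → ¬ Adj u v

  MaximumIndependent : Subset n → Set
  MaximumIndependent I = Independent I × (∀ J → Independent J → ∣ J ∣ ≤ ∣ I ∣)

  Nbhd : VSet → VSet
  Nbhd X v = ¬ X v × Σ (Fin n) (λ x → X x × Adj x v)

  HasNbrIn : Fin n → VSet → Set
  HasNbrIn v S = Σ (Fin n) (λ w → S w × Adj v w)

  module Packs (I : Subset n) where
    Pack : Fin n → VSet
    Pack a v = v ∉ I × (∀ u → u ∈ I → (Adj v u → u ≡ a) × (u ≡ a → Adj v u))

    T0 : Fin n → VSet
    T0 a v = Pack a v × (∀ c → c ∈ I → c ≢ a → ¬ HasNbrIn v (Pack c))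

    T1 : Fin n → Fin n → VSet
    T1 a b v = Pack a v × HasNbrIn v (Pack b) ×
               (∀ c → c ∈ I → c ≢ a → c ≢ b → ¬ HasNbrIn v (Pack c))

    T2 : Fin n → VSet
    T2 a v = Pack a v × Σ (Fin n) (λ c → Σ (Fin n) (λ d →
               c ∈ I × d ∈ I × c ≢ d × c ≢ a × d ≢ a ×
               HasNbrIn v (Pack c) × HasNbrIn v (Pack d)))

module Submission where

-- Fix any vertex set I and
-- write V_p for the 1-pack of p ∈ I.  Everything rests on one consequence
-- of claw-freeness, the "pack triangle" lemma: if p, q, r ∈ I are distinct
-- and x ∈ V_p has neighbours y ∈ V_q and z ∈ V_r, then y ~ z, for otherwise
-- x together with p, y, z would induce a claw (p is adjacent to neither y
-- nor z because their only I-neighbours are q and r).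
--
-- Consequently, along an edge x ~ v with x ∈ V_a, v ∈ V_b (a ≠ b), every
-- 1-pack V_e with e ∉ {a, b} met by N(x) is also met by N(v).  Read
-- contrapositively this says that "N(x) meets no pack other than V_a, V_b"
-- passes from x to v; this gives both inclusions of N(T1^a_b) ∩ V_b = T1^b_a.
-- Read directly, it moves a third pack seen from T2^a over to v, which
-- gives N(T2^a) ∩ V_b ⊆ T2^b.

open import Defs
open import Data.Nat using (ℕ)
open import Data.Fin using (Fin; _≟_)
open import Data.Fin.Subset using (Subset; _∈_)
open import Data.Product using (_×_; _,_; proj₁; proj₂)
open import Data.Bool using (true)
import Data.Bool.Properties as Bool
open import Relation.Nullary using (¬_; yes; no)
open import Relation.Nullary.Decidable using (decidable-stable)
open import Relation.Binary.PropositionalEquality using (_≢_; _≡_; refl; sym; trans)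

module PackFacts {n : ℕ} (G : Graph n) (I : Subset n) where
  open Packs G I

  adj-sym : ∀ {u v} → Adj G u v → Adj G v u
  adj-sym {u} {v} uv = trans (Graph.sym G v u) uv

  pack-adj : ∀ {p w} → p ∈ I → Pack p w → Adj G w p
  pack-adj {p} p∈I Pw = proj₂ (proj₂ Pw p p∈I) refl

  pack-nonadj : ∀ {p u w} → Pack p w → u ∈ I → u ≢ p → ¬ Adj G u w
  pack-nonadj {u = u} Pw u∈I u≢p uw = u≢p (proj₁ (proj₂ Pw u u∈I) (adj-sym uw))

  pack-unique : ∀ {p q w} → q ∈ I → Pack p w → Pack q w → q ≡ p
  pack-unique {p} {q} q∈I Pw Qw = proj₁ (proj₂ Pw q q∈I) (pack-adj q∈I Qw)

  pack-vertices-distinct : ∀ {p q w w'} → q ∈ I → q ≢ p →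
                           Pack p w → Pack q w' → w ≢ w'
  pack-vertices-distinct q∈I q≢p Pw Qw' refl = q≢p (pack-unique q∈I Pw Qw')

  I-vertex≢pack-vertex : ∀ {p u w} → u ∈ I → Pack p w → u ≢ w
  I-vertex≢pack-vertex u∈I Pw refl = proj₁ Pw u∈I

  -- Pack triangle lemma: two neighbours of x ∈ V_p lying in the packs of
  -- two further distinct members of I are adjacent, else {x; p, y, z}
  -- is a claw.
  pack-triangle : ClawFree G → ∀ {p q r x y z} → p ∈ I → q ∈ I → r ∈ I →
                  q ≢ p → r ≢ p → r ≢ q →
                  Pack p x → Pack q y → Pack r z →
                  Adj G x y → Adj G x z → Adj G y z
  pack-triangle claw-free {p} {y = y} {z} p∈I q∈I r∈I q≢p r≢p r≢q Px Qy Rz xy xz =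
    decidable-stable (Graph.adj G y z Bool.≟ true) λ y≁z →
      claw-free _ p y z (pack-adj p∈I Px) xy xz
        (I-vertex≢pack-vertex p∈I Qy) (I-vertex≢pack-vertex p∈I Rz)
        (pack-vertices-distinct r∈I r≢q Qy Rz)
        (pack-nonadj Qy p∈I (λ p≡q → q≢p (sym p≡q)))
        (pack-nonadj Rz p∈I (λ p≡r → r≢p (sym p≡r)))
        y≁z

  third-pack-transfer : ClawFree G → ∀ {a b e x v} → a ∈ I → b ∈ I → e ∈ I →
                        a ≢ b → e ≢ a → e ≢ b →
                        Pack a x → Pack b v → Adj G x v →
                        HasNbrIn G x (Pack e) → HasNbrIn G v (Pack e)
  third-pack-transfer claw-free a∈I b∈I e∈I a≢b e≢a e≢b Ax Bv xv (w , Ew , xw) =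
    w , Ew , pack-triangle claw-free a∈I b∈I e∈I (λ b≡a → a≢b (sym b≡a)) e≢a e≢b
                           Ax Bv Ew xv xw

  OnlyPacks : Fin n → Fin n → Fin n → Set
  OnlyPacks x a b = ∀ c → c ∈ I → c ≢ a → c ≢ b → ¬ HasNbrIn G x (Pack c)

  -- Contrapositive of the transfer: OnlyPacks passes across an edge
  -- between V_a and V_b.
  only-packs-transfer : ClawFree G → ∀ {a b x v} → a ∈ I → b ∈ I → a ≢ b →
                        Pack a x → Pack b v → Adj G x v →
                        OnlyPacks x a b → OnlyPacks v b a
  only-packs-transfer claw-free a∈I b∈I a≢b Ax Bv xv only-x c c∈I c≢b c≢a v-meets-c =
    only-x c c∈I c≢a c≢b
      (third-pack-transfer claw-free b∈I a∈I c∈I (λ b≡a → a≢b (sym b≡a)) c≢b c≢a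
                           Bv Ax (adj-sym xv) v-meets-c)

  T1-neighbours : ClawFree G → ∀ {a b v} → a ∈ I → b ∈ I → a ≢ b →
                  Nbhd G (T1 a b) v × Pack b v → T1 b a v
  T1-neighbours claw-free a∈I b∈I a≢b ((_ , x , (Ax , _ , only-x) , xv) , Bv) =
    Bv , (x , Ax , adj-sym xv) , only-packs-transfer claw-free a∈I b∈I a≢b Ax Bv xv only-x

  -- T1^b_a ⊆ N(T1^a_b) ∩ V_b: the neighbour x ∈ V_a of v lies in T1^a_b,
  -- while v itself does not, since V_a and V_b are disjoint.
  T1-covered : ClawFree G → ∀ {a b v} → a ∈ I → b ∈ I → a ≢ b →
               T1 b a v → Nbhd G (T1 a b) v × Pack b v
  T1-covered claw-free a∈I b∈I a≢b (Bv , (x , Ax , vx) , only-v) =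
    ( (λ T1v → a≢b (sym (pack-unique b∈I (proj₁ T1v) Bv)))
    , x
    , (Ax , (_ , Bv , adj-sym vx)
          , only-packs-transfer claw-free b∈I a∈I (λ b≡a → a≢b (sym b≡a))
                                Bv Ax vx only-v)
    , adj-sym vx )
    , Bv

  -- A vertex v ∈ V_b adjacent to x ∈ V_a is in T2^b as soon as N(x) meets
  -- a pack V_e with e ∉ {a, b}: v sees V_a directly and V_e by transfer.
  T2-via-third-pack : ClawFree G → ∀ {a b e x v} → a ∈ I → b ∈ I → e ∈ I →
                      a ≢ b → e ≢ a → e ≢ b →
                      Pack a x → Pack b v → Adj G x v →
                      HasNbrIn G x (Pack e) → T2 b v
  T2-via-third-pack claw-free a∈I b∈I e∈I a≢b e≢a e≢b Ax Bv xv x-meets-e =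
    Bv , _ , _ , a∈I , e∈I , (λ a≡e → e≢a (sym a≡e)) , a≢b , e≢b
       , (_ , Ax , adj-sym xv)
       , third-pack-transfer claw-free a∈I b∈I e∈I a≢b e≢a e≢b Ax Bv xv x-meets-e

  -- N(T2^a) ∩ V_b ⊆ T2^b: of the two further packs seen by x ∈ T2^a, at
  -- least one differs from V_b.
  T2-neighbours : ClawFree G → ∀ {a b v} → a ∈ I → b ∈ I → a ≢ b →
                  Nbhd G (T2 a) v × Pack b v → T2 b v
  T2-neighbours claw-free {b = b} a∈I b∈I a≢b
      ((_ , x , (Ax , c , d , c∈I , d∈I , c≢d , c≢a , d≢a , x-meets-c , x-meets-d) , xv) , Bv)
    with c ≟ b
  ... | yes refl = T2-via-third-pack claw-free a∈I b∈I d∈I a≢b d≢a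
                     (λ d≡c → c≢d (sym d≡c)) Ax Bv xv x-meets-d
  ... | no c≢b   = T2-via-third-pack claw-free a∈I b∈I c∈I a≢b c≢a c≢b Ax Bv xv x-meets-c

-- Lemma 2.1.
lemma21 : ∀ {n : ℕ} (G : Graph n) (I : Subset n) → ClawFree G → MaximumIndependent G I → ∀ (a b : Fin n) → a ∈ I → b ∈ I → a ≢ b → (∀ v → (Nbhd G (Packs.T1 G I a b) v × Packs.Pack G I b v → Packs.T1 G I b a v) × (Packs.T1 G I b a v → Nbhd G (Packs.T1 G I a b) v × Packs.Pack G I b v)) × (∀ v → Nbhd G (Packs.T2 G I a) v × Packs.Pack G I b v → Packs.T2 G I b v)
lemma21 G I claw-free _ a b a∈I b∈I a≢b =
    (λ v → T1-neighbours claw-free a∈I b∈I a≢b , T1-covered claw-free a∈I b∈I a≢b)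
  , (λ v → T2-neighbours claw-free a∈I b∈I a≢b)
  where open PackFacts G I
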